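{- Let $G$ be a finite $\Sigma^\circ$-labeled graph and $Z$ an acyclic zone (no directed cycle) of the zoning of $G$. If every bad vertex of $Z$ is relabeled with $\bot$, then $Z$ is isomorphic to a term encoding $t^\circ$ for some (linear) term $t$ over $\Sigma$.
   Context: $\Sigma$ is a signature with arities $\#$; $\Sigma^\circ=(\Sigma\uplus\mathbb{N}^+)\uplus\{\bot,\top\}$ is the flat lattice ($\bot$ least, $\top$ greatest, others incomparable); a $\Sigma^\circ$-labeled graph has vertices and edges labeled in $\Sigma^\circ$, with source and target maps $s,t$. A vertex $v$ is in-well-formed (I) if it has at most one incoming edge; it is out-well-formed (O) if its label $l$ lies in $\Sigma$ and $v$ has precisely $\#(l)$ outgoing edges, labeled $1,2,\ldots,\#(l)$. A vertex is good if it is O and all its children (targets of its outgoing edges) are I; otherwise it is bad. The zoning of $G$: initially each vertex forms its own zone (a subgraph); repeatedly, if an edge $e$ is not included in any zone and $s(e)$ is good, the zones of $s(e)$ and $t(e)$ are joined along $e$ (if they are the same zone, $e$ is added to it); stop when no such edge remains. For a linear term $t$ over $\Sigma$ and variables $\mathcal{X}$, the term encoding $t^\circ$ is the graph with a vertex $p$ labeled $f$ for each position $p$ of $t$ holding a function symbol $f$, a vertex $x$ labeled $\bot$ for each variable $x$ of $t$, and for each position $p$ holding a symbol of arity $n$ and each $1\le i\le n$ an edge labeled $i$ from the vertex at $p$ to the vertex at position $pi$ (positions being sequences of positive integers, $\epsilon$ the root, $pi$ the $i$-th argument below $p$). -}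

module Defs where

open import Data.Nat using (ℕ; zero; suc)
open import Data.Fin using (Fin; toℕ)
open import Data.Product using (Σ; ∃; _×_; _,_)
open import Relation.Nullary using (¬_)
open import Relation.Binary.PropositionalEquality using (_≡_)
open import Relation.Binary.Construct.Closure.Equivalence using (EqClosure)
open import Relation.Binary.Construct.Closure.Transitive using (TransClosure)

record Signature : Set₁ where
  field
    Sym : Set
    # : Sym → ℕ

module _ (S : Signature) where
  open Signature S

  -- Labels Σ° = (Σ ⊎ ℕ⁺) ⊎ {⊥, ⊤}.
  -- The positive integer n+1 is represented as  pos n .
  -- (The flat lattice order is not needed for this statement.)
  data Label : Set where
    sym : Sym → Label
    pos : ℕ → Label
    bot : Label
    top : Label

  -- The edge label "i" for i ∈ {1,…,k} represented by  j : Fin k  (i = j+1).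
  numLabel : {k : ℕ} → Fin k → Label
  numLabel j = pos (toℕ j)

  record FinGraph : Set where
    field
      nV   : ℕ
      nE   : ℕ
      lab  : Fin nV → Label
      elab : Fin nE → Label
      src  : Fin nE → Fin nV
      tgt  : Fin nE → Fin nV

  record Graph : Set₁ where
    field
      V    : Set
      E    : Set
      lab  : V → Label
      elab : E → Label
      src  : E → V
      tgt  : E → V

  module _ (G : FinGraph) where
    open FinGraph G

    InWF : Fin nV → Set
    InWF v = ∀ e e′ → tgt e ≡ v → tgt e′ ≡ v → e ≡ e′

    OutWF : Fin nV → Set
    OutWF v = Σ Sym λ f → lab v ≡ sym f
      × (∀ e → src e ≡ v → ∃ λ (i : Fin (# f)) → elab e ≡ numLabel i)
      × (∀ (i : Fin (# f)) →
           (∃ λ e → src e ≡ v × elab e ≡ numLabel i)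
         × (∀ e e′ → src e ≡ v → elab e ≡ numLabel i
                   → src e′ ≡ v → elab e′ ≡ numLabel i → e ≡ e′))

    Good : Fin nV → Set
    Good v = OutWF v × (∀ e → src e ≡ v → InWF (tgt e))

    Bad : Fin nV → Set
    Bad v = ¬ Good v

    -- Edges are only ever added to zones when their source is
    -- good, and the process stops exactly when every edge with a good
    -- source is included in a zone.  Joining zones along e merges the
    -- (undirected) connected components.  Hence the final zoning is:
    -- the zone of a vertex r has as vertices all v connected to r via
    -- good-source edges (ignoring direction), and as edges all
    -- good-source edges whose source lies in that zone.
    GoodStep : Fin nV → Fin nV → Set
    GoodStep u w = ∃ λ e → Good (src e) × src e ≡ u × tgt e ≡ w

    SameZone : Fin nV → Fin nV → Set
    SameZone = EqClosure GoodStep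

    InZoneV : Fin nV → Fin nV → Set
    InZoneV r v = SameZone r v

    InZoneE : Fin nV → Fin nE → Set
    InZoneE r e = Good (src e) × SameZone r (src e)

    ZoneStep : Fin nV → Fin nV → Fin nV → Set
    ZoneStep r u w = ∃ λ e → InZoneE r e × src e ≡ u × tgt e ≡ w

    AcyclicZone : Fin nV → Set
    AcyclicZone r = ∀ v → ¬ TransClosure (ZoneStep r) v v

  data Term (X : Set) : Set where
    var : X → Term X
    app : (f : Sym) → (Fin (# f) → Term X) → Term X

  module _ {X : Set} where
    data Pos : Term X → Set where
      here  : ∀ {t} → Pos t
      below : ∀ {f ts} (i : Fin (# f)) → Pos (ts i) → Pos (app f ts)

    subAt : ∀ {t} → Pos t → Term X
    subAt {t} here = t
    subAt (below i p) = subAt p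

    Linear : Term X → Set
    Linear t = ∀ (p q : Pos t) (x : X) → subAt p ≡ var x → subAt q ≡ var x → p ≡ q

    headLabel : Term X → Label
    headLabel (var x) = bot
    headLabel (app f ts) = sym f

    headArity : Term X → ℕ
    headArity (var x) = 0
    headArity (app f ts) = # f

    -- the position p·i, i.e. the (i+1)-th argument below p
    child : ∀ {t} (p : Pos t) → Fin (headArity (subAt p)) → Pos t
    child {app f ts} here i = below i here
    child (below j p) i = below j (child p i)

    -- Vertices are the positions of t: a position
    -- holding f is labeled f; a position holding a variable x is labeled
    -- ⊥ (for a linear term, variable vertices x correspond one-to-one to
    -- their unique positions).
    encode : Term X → Graph
    encode t = record
      { V    = Pos t
      ; E    = Σ (Pos t) (λ p → Fin (headArity (subAt p)))
      ; lab  = λ p → headLabel (subAt p)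
      ; elab = λ { (p , i) → numLabel i }
      ; src  = λ { (p , i) → p }
      ; tgt  = λ { (p , i) → child p i }
      }

  -- "Z(r), with every bad vertex relabeled ⊥, is isomorphic to H":
  -- a vertex bijection φ : V(H) → Z(r) and an edge bijection ψ : E(H) → Z(r)
  -- (injective maps into G whose images are exactly the vertices / edges
  -- of the zone), commuting with source and target, preserving edge
  -- labels, and preserving vertex labels after relabeling bad vertices by ⊥.
  module _ (G : FinGraph) where
    open FinGraph G

    record ZoneIso (r : Fin nV) (H : Graph) : Set where
      private module H = Graph H
      field
        φ      : H.V → Fin nV
        ψ      : H.E → Fin nE
        φ-inj  : ∀ a b → φ a ≡ φ b → a ≡ b
        ψ-inj  : ∀ a b → ψ a ≡ ψ b → a ≡ b
        φ-into : ∀ a → InZoneV G r (φ a)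
        φ-onto : ∀ v → InZoneV G r v → ∃ λ a → φ a ≡ v
        ψ-into : ∀ a → InZoneE G r (ψ a)
        ψ-onto : ∀ e → InZoneE G r e → ∃ λ a → ψ a ≡ e
        src-hom : ∀ a → src (ψ a) ≡ φ (H.src a)
        tgt-hom : ∀ a → tgt (ψ a) ≡ φ (H.tgt a)
        elab-hom : ∀ a → elab (ψ a) ≡ H.elab a
        lab-good : ∀ a → Good G (φ a) → H.lab a ≡ lab (φ a)
        lab-bad  : ∀ a → Bad G (φ a) → H.lab a ≡ bot

{-# OPTIONS --safe #-}
module Submission where

open import Defs
open import Data.Nat using (ℕ)
open import Data.Fin using (Fin)
open import Data.Product using (Σ; _×_)

import Data.Nat.Properties as ℕ
open import Data.Fin using (toℕ)
open import Data.Fin.Properties using (_≟_; all?; any?; toℕ-injective)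
open import Data.Fin.Induction using (spo-wellFounded; spo-noetherian)
open import Data.Product using (∃; ∃₂; _,_; proj₁; proj₂; uncurry)
open import Data.Sum using (_⊎_; inj₁; inj₂)
open import Data.Empty using (⊥-elim)
open import Function using (_∘_; flip; id)
open import Relation.Nullary using (¬_; Dec; yes; no)
open import Relation.Nullary.Decidable using (map′; _×-dec_; _→-dec_)
open import Relation.Binary.Core using (Rel)
open import Relation.Binary.Structures using (IsStrictPartialOrder)
open import Relation.Binary.PropositionalEquality as ≡
  using (_≡_; _≢_; refl; cong; subst; trans)
open import Relation.Binary.Construct.Closure.Transitive using (TransClosure; [_]; _∷_; _++_)
open import Relation.Binary.Construct.Closure.Symmetric using (SymClosure; fwd; bwd)
open import Relation.Binary.Construct.Closure.ReflexiveTransitive as Star using (Star; ε; _◅_; _◅◅_)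
open import Relation.Binary.Construct.Closure.Equivalence as EqClosure using (EqClosure)
open import Induction.WellFounded using (Acc; acc; WellFounded; module Subrelation)

-- In the zone of r, a good vertex has exactly one zone edge per argument
-- position and its children have in-degree at most one; acyclicity makes
-- the zone's edge relation well-founded in both directions.  Walking
-- backwards along zone edges thus reaches a root with no incoming zone
-- edge, and unfolding forwards from it terminates in a term t: a good
-- vertex becomes its symbol applied to the unfoldings of its children, a
-- bad vertex becomes a variable named after the vertex.  Positions of t map
-- injectively into the zone: the root position is pinned down by
-- acyclicity, any other one by its unique incoming edge.  For the same
-- reason the image is closed under zone edges in both directions, hence is
-- the whole zone.  Linearity of t follows, as variables name vertices.

module _ {n ℓ} {_⟶_ : Rel (Fin n) ℓ} (acyclic : ∀ v → ¬ TransClosure _⟶_ v v) where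

  private
    ⁺-isStrictPartialOrder : IsStrictPartialOrder _≡_ (TransClosure _⟶_)
    ⁺-isStrictPartialOrder = record
      { isEquivalence = ≡.isEquivalence
      ; irrefl        = λ { refl → acyclic _ }
      ; trans         = _++_
      ; <-resp-≈      = (λ { refl → id }) , (λ { refl → id })
      }

  acyclic⇒wellFounded : WellFounded _⟶_
  acyclic⇒wellFounded = Subrelation.wellFounded [_] (spo-wellFounded ⁺-isStrictPartialOrder)

  acyclic⇒noetherian : WellFounded (flip _⟶_)
  acyclic⇒noetherian = Subrelation.wellFounded [_] (spo-noetherian ⁺-isStrictPartialOrder)

infixr 5 _◅⁺_

_◅⁺_ : ∀ {a ℓ} {A : Set a} {_∼_ : Rel A ℓ} {x y z} →
       x ∼ y → Star _∼_ y z → TransClosure _∼_ x z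
x∼y ◅⁺ ε          = [ x∼y ]
x∼y ◅⁺ (y∼z ◅ zs) = x∼y ∷ (y∼z ◅⁺ zs)

module _ {S : Signature} where
  open Signature S

  pos-injective : ∀ {m n} → pos {S} m ≡ pos n → m ≡ n
  pos-injective refl = refl

  numLabel-injective : ∀ {k} {i j : Fin k} → numLabel S i ≡ numLabel S j → i ≡ j
  numLabel-injective = toℕ-injective ∘ pos-injective

  _≟numLabel_ : (l : Label S) {k : ℕ} (i : Fin k) → Dec (l ≡ numLabel S i)
  pos m ≟numLabel i = map′ (cong pos) pos-injective (m ℕ.≟ toℕ i)
  sym _ ≟numLabel _ = no λ ()
  bot   ≟numLabel _ = no λ ()
  top   ≟numLabel _ = no λ ()

  ∃-sym? : (l : Label S) {P : Sym → Set} → (∀ f → Dec (P f)) →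
           Dec (∃ λ f → l ≡ sym f × P f)
  ∃-sym? (sym f) P? = map′ (λ Pf → f , refl , Pf) (λ { (_ , refl , Pf) → Pf }) (P? f)
  ∃-sym? (pos _) _  = no λ { (_ , () , _) }
  ∃-sym? bot     _  = no λ { (_ , () , _) }
  ∃-sym? top     _  = no λ { (_ , () , _) }

module _ {S : Signature} {X : Set} where

  data PosView {t : Term S X} : Pos S t → Set where
    at-root  : PosView here
    at-child : ∀ {q} (k : Fin (headArity S (subAt S q))) → PosView q → PosView (child S q k)

  below-view : ∀ {f ts} i {p : Pos S (ts i)} → PosView p → PosView {app f ts} (below i p)
  below-view i at-root        = at-child i at-root
  below-view i (at-child k v) = at-child k (below-view i v)

  posView : ∀ {t} (p : Pos S t) → PosView p
  posView here        = at-root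
  posView (below i p) = below-view i (posView p)

  child≢here : ∀ {t : Term S X} (q : Pos S t) k → child S q k ≢ here
  child≢here {app _ _} here        _ ()
  child≢here           (below _ _) _ ()

module Zoning (S : Signature) (G : FinGraph S) where
  open Signature S
  open FinGraph G

  InWF? : ∀ v → Dec (InWF S G v)
  InWF? v = all? λ e → all? λ e′ → tgt e ≟ v →-dec tgt e′ ≟ v →-dec e ≟ e′

  OutEdges : Fin nV → Sym → Set
  OutEdges v f =
      (∀ e → src e ≡ v → ∃ λ (i : Fin (# f)) → elab e ≡ numLabel S i)
    × (∀ (i : Fin (# f)) →
         (∃ λ e → src e ≡ v × elab e ≡ numLabel S i)
       × (∀ e e′ → src e ≡ v → elab e ≡ numLabel S i
                 → src e′ ≡ v → elab e′ ≡ numLabel S i → e ≡ e′))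

  OutEdges? : ∀ v f → Dec (OutEdges v f)
  OutEdges? v f =
    (all? λ e → src e ≟ v →-dec any? λ i → elab e ≟numLabel i)
    ×-dec all? λ i →
      (any? λ e → src e ≟ v ×-dec elab e ≟numLabel i)
      ×-dec (all? λ e → all? λ e′ →
               src e ≟ v →-dec elab e ≟numLabel i →-dec
               src e′ ≟ v →-dec elab e′ ≟numLabel i →-dec e ≟ e′)

  OutWF? : ∀ v → Dec (OutWF S G v)
  OutWF? v = ∃-sym? (lab v) (OutEdges? v)

  Good? : ∀ v → Dec (Good S G v)
  Good? v = OutWF? v ×-dec all? λ e → src e ≟ v →-dec InWF? (tgt e)

  module _ {v : Fin nV} where

    head : Good S G v → Sym
    head ((f , _) , _) = f

    lab-head : (g : Good S G v) → lab v ≡ sym (head g)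
    lab-head ((_ , lab≡ , _) , _) = lab≡

    arg : (g : Good S G v) → Fin (# (head g)) → Fin nE
    arg ((_ , _ , _ , args) , _) i = proj₁ (proj₁ (args i))

    arg-src : (g : Good S G v) → ∀ i → src (arg g i) ≡ v
    arg-src ((_ , _ , _ , args) , _) i = proj₁ (proj₂ (proj₁ (args i)))

    arg-elab : (g : Good S G v) → ∀ i → elab (arg g i) ≡ numLabel S i
    arg-elab ((_ , _ , _ , args) , _) i = proj₂ (proj₂ (proj₁ (args i)))

    outgoing-arg : (g : Good S G v) → ∀ e → src e ≡ v → ∃ λ i → arg g i ≡ e
    outgoing-arg g@((_ , _ , outgoing , args) , _) e e-src =
      let i , e-elab = outgoing e e-src
      in  i , proj₂ (args i) _ _ (arg-src g i) (arg-elab g i) e-src e-elab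

    arg-InWF : (g : Good S G v) → ∀ i → InWF S G (tgt (arg g i))
    arg-InWF g@(_ , children-InWF) i = children-InWF (arg g i) (arg-src g i)

    arg-step : (g : Good S G v) → ∀ i → GoodStep S G v (tgt (arg g i))
    arg-step g i = arg g i , subst (Good S G) (≡.sym (arg-src g i)) g , arg-src g i , refl

  data Unfolding : Fin nV → Term S ℕ → Set where
    leaf : ∀ {v} → Bad S G v → Unfolding v (var (toℕ v))
    node : ∀ {v} (g : Good S G v) {ts} →
           (∀ i → Unfolding (tgt (arg g i)) (ts i)) → Unfolding v (app (head g) ts)

  module _ {w : Fin nV} {s : Term S ℕ} where

    argEdge : Unfolding w s → Fin (headArity S s) → Fin nE
    argEdge (node g _) = arg g

    argEdge-src : (U : Unfolding w s) → ∀ k → src (argEdge U k) ≡ w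
    argEdge-src (node g _) = arg-src g

    argEdge-elab : (U : Unfolding w s) → ∀ k → elab (argEdge U k) ≡ numLabel S k
    argEdge-elab (node g _) = arg-elab g

    argEdge-good : (U : Unfolding w s) → Fin (headArity S s) → Good S G w
    argEdge-good (node g _) _ = g

    argEdge-onto : (U : Unfolding w s) → Good S G w →
                   ∀ e → src e ≡ w → ∃ λ k → argEdge U k ≡ e
    argEdge-onto (leaf bad)  good = ⊥-elim (bad good)
    argEdge-onto (node g _)  _    = outgoing-arg g

    headLabel-good : Unfolding w s → Good S G w → headLabel S s ≡ lab w
    headLabel-good (leaf bad) good = ⊥-elim (bad good)
    headLabel-good (node g _) _    = ≡.sym (lab-head g)

    headLabel-bad : Unfolding w s → Bad S G w → headLabel S s ≡ bot
    headLabel-bad (leaf _)   _   = refl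
    headLabel-bad (node g _) bad = ⊥-elim (bad g)

    var-unfolding : Unfolding w s → ∀ {x} → s ≡ var x → x ≡ toℕ w
    var-unfolding (leaf _) refl = refl

  vertexAt : ∀ {u t} → Unfolding u t → Pos S t → Fin nV
  vertexAt {u} _          here        = u
  vertexAt     (node _ U) (below i p) = vertexAt (U i) p

  unfoldingAt : ∀ {u t} (U : Unfolding u t) (p : Pos S t) → Unfolding (vertexAt U p) (subAt S p)
  unfoldingAt U          here        = U
  unfoldingAt (node _ U) (below i p) = unfoldingAt (U i) p

  module _ {u : Fin nV} {t : Term S ℕ} where

    Image : Unfolding u t → Fin nV → Set
    Image U w = ∃ λ p → vertexAt U p ≡ w

    edgeAt : (U : Unfolding u t) (p : Pos S t) → Fin (headArity S (subAt S p)) → Fin nE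
    edgeAt U p = argEdge (unfoldingAt U p)

    edgeAt-src : (U : Unfolding u t) → ∀ p k → src (edgeAt U p k) ≡ vertexAt U p
    edgeAt-src U p = argEdge-src (unfoldingAt U p)

    edgeAt-elab : (U : Unfolding u t) → ∀ p k → elab (edgeAt U p k) ≡ numLabel S k
    edgeAt-elab U p = argEdge-elab (unfoldingAt U p)

  edgeAt-tgt : ∀ {u t} (U : Unfolding u t) → ∀ p k → tgt (edgeAt U p k) ≡ vertexAt U (child S p k)
  edgeAt-tgt (node _ _) here        _ = refl
  edgeAt-tgt (node _ U) (below i p) k = edgeAt-tgt (U i) p k

  edgeInto-vertexAt : ∀ {u t} (U : Unfolding u t) → ∀ p e → tgt e ≡ vertexAt U p →
                      p ≡ here ⊎ ∃₂ λ q k → p ≡ child S q k × edgeAt U q k ≡ e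
  edgeInto-vertexAt U here _ _ = inj₁ refl
  edgeInto-vertexAt (node g U) (below i p) e e-tgt with edgeInto-vertexAt (U i) p e e-tgt
  ... | inj₁ refl                = inj₂ (here , i , refl , arg-InWF g i _ e refl e-tgt)
  ... | inj₂ (q , k , refl , eq) = inj₂ (below i q , k , refl , eq)

  module _ {u t} (U : Unfolding u t) where
    open ≡.≡-Reasoning

    edgeAt-injective : ∀ {p} → (∀ q → vertexAt U p ≡ vertexAt U q → p ≡ q) →
                       ∀ k q l → edgeAt U p k ≡ edgeAt U q l → (p , k) ≡ (q , l)
    edgeAt-injective {p} p-determined k q l eq
      with p-determined q (begin
             vertexAt U p        ≡⟨ edgeAt-src U p k ⟨
             src (edgeAt U p k)  ≡⟨ cong src eq ⟩
             src (edgeAt U q l)  ≡⟨ edgeAt-src U q l ⟩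
             vertexAt U q        ∎)
    ... | refl = cong (p ,_) (numLabel-injective (begin
             numLabel S k        ≡⟨ edgeAt-elab U p k ⟨
             elab (edgeAt U p k) ≡⟨ cong elab eq ⟩
             elab (edgeAt U p l) ≡⟨ edgeAt-elab U p l ⟩
             numLabel S l        ∎))

  IsRoot : Fin nV → Set
  IsRoot u = ∀ e → Good S G (src e) → tgt e ≢ u

  module _ {u t} (U : Unfolding u t) (root : IsRoot u) where

    image-closed : ∀ {x w} → SymClosure (GoodStep S G) x w → Image U x → Image U w
    image-closed (fwd (e , good , e-src , e-tgt)) (p , refl) =
      let k , eq = argEdge-onto (unfoldingAt U p) (subst (Good S G) e-src good) e e-src
      in  child S p k , trans (≡.sym (edgeAt-tgt U p k)) (trans (cong tgt eq) e-tgt)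
    image-closed (bwd (e , good , e-src , e-tgt)) (p , refl) with edgeInto-vertexAt U p e e-tgt
    ... | inj₁ refl             = ⊥-elim (root e good e-tgt)
    ... | inj₂ (q , k , _ , eq) = q , trans (≡.sym (edgeAt-src U q k)) (trans (cong src eq) e-src)

    image-closed⋆ : ∀ {x w} → EqClosure (GoodStep S G) x w → Image U x → Image U w
    image-closed⋆ ε        = id
    image-closed⋆ (s ◅ ss) = image-closed⋆ ss ∘ image-closed s

  module _ {r : Fin nV} where

    goodStep⇒zoneStep : ∀ {u w} → SameZone S G r u → GoodStep S G u w → ZoneStep S G r u w
    goodStep⇒zoneStep u-in (e , good , e-src , e-tgt) =
      e , (good , subst (SameZone S G r) (≡.sym e-src) u-in) , e-src , e-tgt

    zoneStep⇒goodStep : ∀ {u w} → ZoneStep S G r u w → GoodStep S G u w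
    zoneStep⇒goodStep (e , (good , _) , e-src , e-tgt) = e , good , e-src , e-tgt

    zoneStep-inZone : ∀ {u w} → SameZone S G r u → ZoneStep S G r u w → SameZone S G r w
    zoneStep-inZone u-in step = u-in ◅◅ fwd (zoneStep⇒goodStep step) ◅ ε

    arg-zoneStep : ∀ {v} → SameZone S G r v → (g : Good S G v) → ∀ i → ZoneStep S G r v (tgt (arg g i))
    arg-zoneStep v-in g i = goodStep⇒zoneStep v-in (arg-step g i)

    vertexAt-descends : ∀ {u t} → SameZone S G r u → (U : Unfolding u t) →
                        ∀ p → Star (ZoneStep S G r) u (vertexAt U p)
    vertexAt-descends     u-in U          here        = ε
    vertexAt-descends {u} u-in (node g U) (below i p) =
      step ◅ vertexAt-descends (zoneStep-inZone u-in step) (U i) p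
      where
      step : ZoneStep S G r u (tgt (arg g i))
      step = arg-zoneStep u-in g i

    vertexAt-inZone : ∀ {u t} → SameZone S G r u → (U : Unfolding u t) →
                      ∀ p → SameZone S G r (vertexAt U p)
    vertexAt-inZone u-in U p = u-in ◅◅ Star.map (fwd ∘ zoneStep⇒goodStep) (vertexAt-descends u-in U p)

    edgeAt-inZone : ∀ {u t} → SameZone S G r u → (U : Unfolding u t) →
                    ∀ p k → InZoneE S G r (edgeAt U p k)
    edgeAt-inZone u-in U p k rewrite edgeAt-src U p k =
      argEdge-good (unfoldingAt U p) k , vertexAt-inZone u-in U p

  module _ {r : Fin nV} (acyclic : AcyclicZone S G r) where

    vertexAt≡root⇒here : ∀ {u t} → SameZone S G r u → (U : Unfolding u t) →
                          ∀ p → vertexAt U p ≡ u → p ≡ here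
    vertexAt≡root⇒here     u-in U          here        _  = refl
    vertexAt≡root⇒here {u} u-in (node g U) (below i p) eq =
      ⊥-elim (acyclic _ (step ◅⁺ subst (Star _ _) eq
                                   (vertexAt-descends (zoneStep-inZone u-in step) (U i) p)))
      where
      step : ZoneStep S G r u (tgt (arg g i))
      step = arg-zoneStep u-in g i

    vertexAt-injective : ∀ {u t} → SameZone S G r u → (U : Unfolding u t) →
                         ∀ p q → vertexAt U p ≡ vertexAt U q → p ≡ q
    vertexAt-injective u-in U p = go (posView p)
      where
      go : ∀ {p} → PosView p → ∀ q → vertexAt U p ≡ vertexAt U q → p ≡ q
      go at-root q eq = ≡.sym (vertexAt≡root⇒here u-in U q (≡.sym eq))
      go (at-child {q₁} k v) q eq
        with edgeInto-vertexAt U q (edgeAt U q₁ k) (trans (edgeAt-tgt U q₁ k) eq)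
      ... | inj₁ refl = ⊥-elim (child≢here q₁ k (vertexAt≡root⇒here u-in U (child S q₁ k) eq))
      ... | inj₂ (q₂ , k₂ , refl , eq′) =
        cong (uncurry (child S)) (edgeAt-injective U (go v) k q₂ k₂ (≡.sym eq′))

    root-exists : ∀ {w} → SameZone S G r w → ∃ λ ρ → SameZone S G r ρ × IsRoot ρ
    root-exists = go (acyclic⇒wellFounded acyclic _)
      where
      go : ∀ {w} → Acc (ZoneStep S G r) w → SameZone S G r w → ∃ λ ρ → SameZone S G r ρ × IsRoot ρ
      go {w} (acc rs) w-in with any? (λ e → Good? (src e) ×-dec tgt e ≟ w)
      ... | no ¬entered            = w , w-in , λ e good e-tgt → ¬entered (e , good , e-tgt)
      ... | yes (e , good , e-tgt) = go (rs (goodStep⇒zoneStep src-in step)) src-in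
        where
        step : GoodStep S G (src e) w
        step = e , good , refl , e-tgt
        src-in : SameZone S G r (src e)
        src-in = w-in ◅◅ bwd step ◅ ε

    unfold : ∀ {w} → SameZone S G r w → ∃ (Unfolding w)
    unfold = go (acyclic⇒noetherian acyclic _)
      where
      go : ∀ {w} → Acc (flip (ZoneStep S G r)) w → SameZone S G r w → ∃ (Unfolding w)
      go {w} (acc rs) w-in with Good? w
      ... | no bad = var (toℕ w) , leaf bad
      ... | yes g  = app (head g) (proj₁ ∘ unfoldArg) , node g (proj₂ ∘ unfoldArg)
        where
        unfoldArg : ∀ i → ∃ (Unfolding (tgt (arg g i)))
        unfoldArg i = go (rs step) (zoneStep-inZone w-in step)
          where
          step : ZoneStep S G r w (tgt (arg g i))
          step = arg-zoneStep w-in g i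

    module _ {ρ t} (ρ-in : SameZone S G r ρ) (root : IsRoot ρ) (U : Unfolding ρ t) where

      unfolding-linear : Linear S t
      unfolding-linear p q x p-var q-var = vertexAt-injective ρ-in U p q (toℕ-injective
        (trans (≡.sym (var-unfolding (unfoldingAt U p) p-var)) (var-unfolding (unfoldingAt U q) q-var)))

      vertexAt-onto : ∀ w → SameZone S G r w → Image U w
      vertexAt-onto w w-in =
        image-closed⋆ U root (EqClosure.symmetric (GoodStep S G) ρ-in ◅◅ w-in) (here , refl)

      edgeAt-onto : ∀ e → InZoneE S G r e → ∃₂ λ p k → edgeAt U p k ≡ e
      edgeAt-onto e (good , src-in) =
        let p , p-src = vertexAt-onto (src e) src-in
            k , eq    = argEdge-onto (unfoldingAt U p) (subst (Good S G) (≡.sym p-src) good)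
                                     e (≡.sym p-src)
        in  p , k , eq

      unfolding-iso : ZoneIso S G r (encode S t)
      unfolding-iso = record
        { φ        = vertexAt U
        ; ψ        = uncurry (edgeAt U)
        ; φ-inj    = vertexAt-injective ρ-in U
        ; ψ-inj    = λ (p , k) (q , l) → edgeAt-injective U (vertexAt-injective ρ-in U p) k q l
        ; φ-into   = vertexAt-inZone ρ-in U
        ; φ-onto   = vertexAt-onto
        ; ψ-into   = uncurry (edgeAt-inZone ρ-in U)
        ; ψ-onto   = λ e e-in → let p , k , eq = edgeAt-onto e e-in in (p , k) , eq
        ; src-hom  = uncurry (edgeAt-src U)
        ; tgt-hom  = uncurry (edgeAt-tgt U)
        ; elab-hom = uncurry (edgeAt-elab U)
        ; lab-good = headLabel-good ∘ unfoldingAt U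
        ; lab-bad  = headLabel-bad ∘ unfoldingAt U
        }

proposition58 : (S : Signature) (G : FinGraph S) (r : Fin (FinGraph.nV G))
    → AcyclicZone S G r
    → Σ (Term S ℕ) λ t → Linear S t × ZoneIso S G r (encode S t)
proposition58 S G r acyclic =
  let ρ , ρ-in , root = root-exists acyclic ε
      t , U           = unfold acyclic ρ-in
  in  t , unfolding-linear acyclic ρ-in root U , unfolding-iso acyclic ρ-in root U
  where open Zoning S G
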